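{- For any hypergraph $H$, $\pi(S(H))\le \pi(H)$.
   Context: A hypergraph $G=(V,E)$ has a finite vertex set and edge set $E\subseteq 2^V$ (edges may have different sizes); $R(G)=\{|F|\colon F\in E\}$. For $G$ on $n$ vertices, $h_n(G)=\sum_{F\in E(G)}1/\binom{n}{|F|}$. $H\subseteq G$ if there is an injective $f\colon V(H)\to V(G)$ with $f(F)\in E(G)$ for all $F\in E(H)$. $\pi_n(H)=\max\{h_n(G)\colon v(G)=n,\ R(G)\subseteq R(H),\ H\not\subseteq G\}$, $\pi(H)=\lim_{n\to\infty}\pi_n(H)$. The suspension $S(H)$ has vertex set $V(H)\cup\{\ast\}$, where $\ast\notin V(H)$ is a new vertex, and edge set $\{F\cup\{\ast\}\colon F\in E(H)\}$. -}

module Defs where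

open import Data.Bool using (true)
open import Data.Empty using (⊥)
open import Data.Nat using (ℕ; zero; suc; _≥_)
open import Data.Nat.Combinatorics using (_C_)
open import Data.Fin using (Fin)
open import Data.Fin.Subset using (Subset; _∈_; ∣_∣)
open import Data.Vec using (_∷_)
open import Data.List using (List; map; foldr)
import Data.List.Membership.Propositional as LM
open import Data.List.Relation.Unary.Unique.Propositional using (Unique)
open import Data.List.Relation.Unary.Unique.Propositional.Properties using (map⁺)
open import Data.Integer using (+_)
open import Data.Rational using (ℚ; 0ℚ; _+_; _/_; _≤_; _<_)
open import Data.Product using (Σ; ∃; _×_; _,_)
open import Function using (_⇔_)
open import Function.Definitions using (Injective)
open import Relation.Binary.PropositionalEquality using (_≡_; refl)

record Hypergraph : Set where
  field
    v      : ℕ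
    edges  : List (Subset v)
    unique : Unique edges
open Hypergraph public

ImageIsEdge : (H G : Hypergraph) → (Fin (v H) → Fin (v G)) → Subset (v H) → Set
ImageIsEdge H G f F =
  Σ (Subset (v G)) λ F' → (F' LM.∈ edges G) ×
    (∀ j → (j ∈ F') ⇔ (Σ (Fin (v H)) λ i → (i ∈ F) × (f i ≡ j)))

_⊆ᴴ_ : Hypergraph → Hypergraph → Set
H ⊆ᴴ G = Σ (Fin (v H) → Fin (v G)) λ f →
  Injective _≡_ _≡_ f × (∀ F → F LM.∈ edges H → ImageIsEdge H G f F)

SizesIn : Hypergraph → Hypergraph → Set
SizesIn G H = ∀ F → F LM.∈ edges G →
  Σ (Subset (v H)) λ F' → (F' LM.∈ edges H) × (∣ F ∣ ≡ ∣ F' ∣)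

-- 1/m in ℚ (only used with m = binom(n,|F|) ≥ 1, so the zero case never occurs)
inv : ℕ → ℚ
inv zero    = 0ℚ
inv (suc m) = + 1 / suc m

h : Hypergraph → ℚ
h G = foldr (λ F acc → inv (v G C ∣ F ∣) + acc) 0ℚ (edges G)

-- G is a competitor in the definition of π_n(H): v(G)=n, R(G) ⊆ R(H), H ⊄ G
Admissible : Hypergraph → ℕ → Hypergraph → Set
Admissible H n G = (v G ≡ n) × SizesIn G H × ((H ⊆ᴴ G) → ⊥)

-- suspension S(H): new vertex ∗ = index 0, old vertex i ↦ suc i,
-- edges F ↦ F ∪ {∗}
private
  cons-inj : {k : ℕ} {x y : Subset k} → (true ∷ x) ≡ (true ∷ y) → x ≡ y
  cons-inj refl = refl
  
S : Hypergraph → Hypergraph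
S H = record
  { v      = suc (v H)
  ; edges  = map (true ∷_) (edges H)
  ; unique = map⁺ cons-inj (unique H)
  }

module Submission where

-- Let G be S(H)-free on n vertices with R(G) ⊆ R(S(H)), so every edge of G has size j + 1 with
-- j ≤ m = v(H). The link of a vertex x (the sets F - x for x ∈ F ∈ E(G), on the same n vertices)
-- has edge sizes in R(H) and is H-free, since an embedding of H into it extends to an embedding
-- of S(H) into G sending ∗ to x. From k C(n,k) = (n - k + 1) C(n,k-1), an edge of size k satisfies
--   n / C(n,k) = k / C(n,k-1) + (k-1) / C(n,k),
-- and summing over the edges gives n h(G) ≤ Σₓ h(link x) + m h(G) ≤ n maxₓ h(link x) + m (m + 2),
-- where h(G) ≤ m + 2 because the edges of each size contribute at most 1 (Lubell).
-- So h(G) ≤ h(link x) + m (m + 2) / n for the best x, and m (m + 2) / n ≤ ε for large n.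

import Algebra.Properties.CommutativeMonoid.Sum as CommutativeMonoidSum
open import Data.Bool.Base using (true; false; if_then_else_; not)
open import Data.Fin.Base using (Fin; zero; suc; fromℕ<)
open import Data.Fin.Properties using (_≟_; any?; all?; ¬∀⟶∃¬; injective⇒≤)
open import Data.Fin.Subset using (Subset; inside; outside; ∣_∣; _∈_; _∉_; _-_; ⁅_⁆)
open import Data.Fin.Subset.Properties using (_∈?_; ∣p∣≤n; ⊆-antisym; p─q⊆p; p─⊥≡p; x∈p∧x≢y⇒x∈p-y)
open import Data.Integer.Base as ℤ using (+_; +≤+; +[1+_]; -[1+_])
import Data.Integer.Properties as ℤ
import Data.List.Extrema
open import Data.List.Base using (List; []; _∷_; [_]; _++_; foldr; map; filter; length; lookup; allFin)
import Data.List.Membership.Propositional as List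
open import Data.List.Membership.Propositional.Properties
  using (∈-map⁺; ∈-map⁻; ∈-++⁺ˡ; ∈-++⁺ʳ; ∈-filter⁻; ∈-lookup; ∈-allFin)
open import Data.List.Properties using (length-map; length-++)
open import Data.List.Relation.Binary.Subset.Propositional using (_⊆_)
open import Data.List.Relation.Unary.All as All using (All; []; _∷_)
open import Data.List.Relation.Unary.All.Properties using (all-filter; map⁺)
open import Data.List.Relation.Unary.Any using (here; there; index)
open import Data.List.Relation.Unary.Any.Properties using (lookup-index)
open import Data.List.Relation.Unary.Unique.Propositional using (Unique; []; _∷_)
import Data.List.Relation.Unary.Unique.Propositional.Properties as Unique
open import Data.Maybe.Base using (nothing)
open import Data.Nat.Base as ℕ using (ℕ; zero; suc; NonZero; >-nonZero; _≥_; z≤n; s≤s)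
import Data.Nat.Properties as ℕ
open import Data.Nat.Combinatorics using (_C_; nCk+nC[k+1]≡[n+1]C[k+1]; nC1≡n)
open import Data.Nat.Coprimality as Coprime using (1-coprimeTo)
open import Data.Product.Base using (Σ; ∃; _×_; _,_; proj₁; proj₂; map₂)
open import Data.Rational.Base using (ℚ; mkℚ; 0ℚ; 1ℚ; _+_; _*_; _/_; 1/_; _≤_; _<_; *≤*; NonNegative; positive)
open import Data.Rational.Properties
  using ( ↥p/↧p≡p; normalize-nonNeg; +-identityˡ; +-identityʳ; +-assoc; +-mono-≤; +-monoʳ-≤
        ; *-zeroˡ; *-zeroʳ; *-identityˡ; *-identityʳ; *-assoc; *-distribˡ-+; *-distribʳ-+; *-inverseʳ
        ; *-monoʳ-≤-nonNeg; *-monoˡ-≤-nonNeg; *-cancelˡ-≤-pos; ≤-refl; ≤-reflexive; ≤-trans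
        ; ≤-decTotalOrder; +-0-commutativeMonoid; +-*-commutativeRing; module ≤-Reasoning )
open import Data.Vec.Base using ([]; _∷_; here; there)
import Data.Vec.Functional as Vector
open import Function.Base using (_∘_)
open import Function.Bundles using (_⇔_; mk⇔; Equivalence)
open import Function.Definitions using (Injective)
open import Relation.Binary.Bundles using (DecTotalOrder)
open import Relation.Binary.PropositionalEquality
  using (_≡_; _≢_; refl; sym; trans; cong; cong₂; subst; module ≡-Reasoning)
open import Relation.Nullary.Decidable.Core using (does; yes; no; ¬?; decidable-stable)
open import Relation.Nullary.Negation using (contradiction)
open import Relation.Unary using (Pred; Decidable)
open import Relation.Unary.Properties using (∁?)
import Tactic.RingSolver.Core.AlmostCommutativeRing as ACR
open import Tactic.RingSolver using (solve-∀)
open import Defs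

open CommutativeMonoidSum +-0-commutativeMonoid
  using (sum; sum-syntax; sum-cong-≗; ∑-distrib-+; sum-replicate-zero)
open Data.List.Extrema (DecTotalOrder.totalOrder ≤-decTotalOrder) using (argmax; f[xs]≤f[argmax])

-- Binomial coefficients and k-subsets

[k+1]*[n+1]C[k+1]≡[n+1]*nCk : ∀ n k → suc k ℕ.* (suc n C suc k) ≡ suc n ℕ.* (n C k)
[k+1]*[n+1]C[k+1]≡[n+1]*nCk n       zero    =
  trans (ℕ.*-identityˡ (suc n C 1)) (trans (nC1≡n (suc n)) (sym (ℕ.*-identityʳ (suc n))))
[k+1]*[n+1]C[k+1]≡[n+1]*nCk zero    (suc k) = ℕ.*-zeroʳ (suc (suc k))
[k+1]*[n+1]C[k+1]≡[n+1]*nCk (suc n) (suc k) = begin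
  suc (suc k) ℕ.* (suc (suc n) C suc (suc k))           ≡⟨ cong (suc (suc k) ℕ.*_) (pascal (suc n) (suc k)) ⟨
  suc (suc k) ℕ.* (A ℕ.+ B)                             ≡⟨ ℕ.*-distribˡ-+ (suc (suc k)) A B ⟩
  A ℕ.+ suc k ℕ.* A ℕ.+ suc (suc k) ℕ.* B               ≡⟨ cong₂ (λ a b → A ℕ.+ a ℕ.+ b)
                                                             ([k+1]*[n+1]C[k+1]≡[n+1]*nCk n k)
                                                             ([k+1]*[n+1]C[k+1]≡[n+1]*nCk n (suc k)) ⟩
  A ℕ.+ suc n ℕ.* (n C k) ℕ.+ suc n ℕ.* (n C suc k)     ≡⟨ ℕ.+-assoc A _ _ ⟩
  A ℕ.+ (suc n ℕ.* (n C k) ℕ.+ suc n ℕ.* (n C suc k))   ≡⟨ cong (A ℕ.+_) (ℕ.*-distribˡ-+ (suc n) (n C k) _) ⟨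
  A ℕ.+ suc n ℕ.* (n C k ℕ.+ n C suc k)                 ≡⟨ cong (λ a → A ℕ.+ suc n ℕ.* a) (pascal n k) ⟩
  suc (suc n) ℕ.* A                                     ∎
  where
  open ≡-Reasoning
  pascal = nCk+nC[k+1]≡[n+1]C[k+1]
  A = suc n C suc k
  B = suc n C suc (suc k)

-- (n - k) C(n,k) = (k + 1) C(n,k+1), with k C(n,k) moved across so that no subtraction occurs.
n*nCk≡[k+1]*nC[k+1]+k*nCk : ∀ n k → n ℕ.* (n C k) ≡ suc k ℕ.* (n C suc k) ℕ.+ k ℕ.* (n C k)
n*nCk≡[k+1]*nC[k+1]+k*nCk zero    zero    = refl
n*nCk≡[k+1]*nC[k+1]+k*nCk zero    (suc k) = sym (cong₂ ℕ._+_ (ℕ.*-zeroʳ (suc (suc k))) (ℕ.*-zeroʳ (suc k)))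
n*nCk≡[k+1]*nC[k+1]+k*nCk (suc n) zero    =
  sym (trans (ℕ.+-identityʳ _) ([k+1]*[n+1]C[k+1]≡[n+1]*nCk n 0))
n*nCk≡[k+1]*nC[k+1]+k*nCk (suc n) (suc k) = begin
  suc n ℕ.* (suc n C suc k)                   ≡⟨ cong (suc n ℕ.*_) (nCk+nC[k+1]≡[n+1]C[k+1] n k) ⟨
  suc n ℕ.* (n C k ℕ.+ n C suc k)             ≡⟨ ℕ.*-distribˡ-+ (suc n) (n C k) _ ⟩
  suc n ℕ.* (n C k) ℕ.+ suc n ℕ.* (n C suc k) ≡⟨ cong₂ ℕ._+_ ([k+1]*[n+1]C[k+1]≡[n+1]*nCk n k)
                                                              ([k+1]*[n+1]C[k+1]≡[n+1]*nCk n (suc k)) ⟨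
  suc k ℕ.* (suc n C suc k) ℕ.+ suc (suc k) ℕ.* (suc n C suc (suc k))
                                              ≡⟨ ℕ.+-comm (suc k ℕ.* (suc n C suc k)) _ ⟩
  suc (suc k) ℕ.* (suc n C suc (suc k)) ℕ.+ suc k ℕ.* (suc n C suc k) ∎
  where open ≡-Reasoning

k≤n⇒nCk>0 : ∀ {n k} → k ℕ.≤ n → 0 ℕ.< n C k
k≤n⇒nCk>0 {k = zero}        _         = s≤s z≤n
k≤n⇒nCk>0 {suc n} {suc k} (s≤s k≤n) = subst (0 ℕ.<_) (nCk+nC[k+1]≡[n+1]C[k+1] n k)
  (ℕ.<-≤-trans (k≤n⇒nCk>0 k≤n) (ℕ.m≤m+n (n C k) _))

subsetsOfSize : ∀ n → ℕ → List (Subset n)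
subsetsOfSize zero    zero    = [ [] ]
subsetsOfSize zero    (suc k) = []
subsetsOfSize (suc n) zero    = map (outside ∷_) (subsetsOfSize n zero)
subsetsOfSize (suc n) (suc k) =
  map (outside ∷_) (subsetsOfSize n (suc k)) ++ map (inside ∷_) (subsetsOfSize n k)

length-subsetsOfSize : ∀ n k → length (subsetsOfSize n k) ≡ n C k
length-subsetsOfSize zero    zero    = refl
length-subsetsOfSize zero    (suc k) = refl
length-subsetsOfSize (suc n) zero    =
  trans (length-map (outside ∷_) (subsetsOfSize n 0)) (length-subsetsOfSize n 0)
length-subsetsOfSize (suc n) (suc k) = begin
  length (map (outside ∷_) A ++ map (inside ∷_) B)          ≡⟨ length-++ (map (outside ∷_) A) ⟩
  length (map (outside ∷_) A) ℕ.+ length (map (inside ∷_) B) ≡⟨ cong₂ ℕ._+_ (length-map _ A) (length-map _ B) ⟩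
  length A ℕ.+ length B                                     ≡⟨ cong₂ ℕ._+_ (length-subsetsOfSize n (suc k))
                                                                            (length-subsetsOfSize n k) ⟩
  n C suc k ℕ.+ n C k                                       ≡⟨ ℕ.+-comm (n C suc k) (n C k) ⟩
  n C k ℕ.+ n C suc k                                       ≡⟨ nCk+nC[k+1]≡[n+1]C[k+1] n k ⟩
  suc n C suc k                                             ∎
  where
  open ≡-Reasoning
  A = subsetsOfSize n (suc k)
  B = subsetsOfSize n k

∈-subsetsOfSize : ∀ {n} (F : Subset n) → F List.∈ subsetsOfSize n ∣ F ∣
∈-subsetsOfSize []            = here refl
∈-subsetsOfSize (inside ∷ F)  = ∈-++⁺ʳ (map (outside ∷_) _) (∈-map⁺ (inside ∷_) (∈-subsetsOfSize F))
∈-subsetsOfSize (outside ∷ F) = outside∷-⊆ ∣ F ∣ (∈-map⁺ (outside ∷_) (∈-subsetsOfSize F))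
  where
  outside∷-⊆ : ∀ {n} k → map (outside ∷_) (subsetsOfSize n k) ⊆ subsetsOfSize (suc n) k
  outside∷-⊆ zero    = λ p → p
  outside∷-⊆ (suc k) = ∈-++⁺ˡ

Unique⇒lookup-injective : ∀ {A : Set} {xs : List A} → Unique xs → Injective _≡_ _≡_ (lookup xs)
Unique⇒lookup-injective (_   ∷ _) {zero}  {zero}  _  = refl
Unique⇒lookup-injective (x∉ ∷ _) {zero}  {suc j} eq = contradiction eq (All.lookup x∉ (∈-lookup j))
Unique⇒lookup-injective (x∉ ∷ _) {suc i} {zero}  eq = contradiction (sym eq) (All.lookup x∉ (∈-lookup i))
Unique⇒lookup-injective (_   ∷ u) {suc i} {suc j} eq = cong suc (Unique⇒lookup-injective u eq)

Unique∧⊆⇒length≤ : ∀ {A : Set} {xs ys : List A} → Unique xs → xs ⊆ ys → length xs ℕ.≤ length ys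
Unique∧⊆⇒length≤ {xs = xs} {ys} u xs⊆ys = injective⇒≤ position-injective
  where
  position : Fin (length xs) → Fin (length ys)
  position i = index (xs⊆ys (∈-lookup i))
  position-injective : Injective _≡_ _≡_ position
  position-injective {i} {j} eq = Unique⇒lookup-injective u (begin
    lookup xs i                ≡⟨ lookup-index (xs⊆ys (∈-lookup i)) ⟩
    lookup ys (position i)     ≡⟨ cong (lookup ys) eq ⟩
    lookup ys (position j)     ≡⟨ lookup-index (xs⊆ys (∈-lookup j)) ⟨
    lookup xs j                ∎)
    where open ≡-Reasoning

length≤nCk : ∀ {n k} {L : List (Subset n)} → Unique L → All (λ F → ∣ F ∣ ≡ k) L → length L ℕ.≤ n C k
length≤nCk {n} {k} u sizes = subst (_ ℕ.≤_) (length-subsetsOfSize n k)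
  (Unique∧⊆⇒length≤ u λ {F} F∈L →
    subst (λ k → F List.∈ subsetsOfSize n k) (All.lookup sizes F∈L) (∈-subsetsOfSize F))

-- Natural numbers and their reciprocals in ℚ

ℚ-ring : ACR.AlmostCommutativeRing _ _
ℚ-ring = ACR.fromCommutativeRing +-*-commutativeRing (λ _ → nothing)

-- A normalised literal, so that instance search finds NonNegative (fromℕ n) and Positive (fromℕ (suc n)).
fromℕ : ℕ → ℚ
fromℕ n = mkℚ (+ n) 0 (Coprime.sym (1-coprimeTo n))

fromℕ-suc : ∀ n → fromℕ (suc n) ≡ 1ℚ + fromℕ n
fromℕ-suc n = begin
  fromℕ (suc n)             ≡⟨ ↥p/↧p≡p (fromℕ (suc n)) ⟨
  + suc n / 1               ≡⟨ cong (λ i → (+ 1 ℤ.+ i) / 1) (ℤ.*-identityʳ (+ n)) ⟨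
  (+ 1 ℤ.+ + n ℤ.* + 1) / 1 ≡⟨⟩
  1ℚ + fromℕ n              ∎
  where open ≡-Reasoning

fromℕ-suc-* : ∀ n q → fromℕ (suc n) * q ≡ q + fromℕ n * q
fromℕ-suc-* n q = begin
  fromℕ (suc n) * q         ≡⟨ cong (_* q) (fromℕ-suc n) ⟩
  (1ℚ + fromℕ n) * q        ≡⟨ *-distribʳ-+ q 1ℚ (fromℕ n) ⟩
  1ℚ * q + fromℕ n * q      ≡⟨ cong (_+ fromℕ n * q) (*-identityˡ q) ⟩
  q + fromℕ n * q           ∎
  where open ≡-Reasoning

fromℕ-+ : ∀ m n → fromℕ (m ℕ.+ n) ≡ fromℕ m + fromℕ n
fromℕ-+ zero    n = sym (+-identityˡ (fromℕ n))
fromℕ-+ (suc m) n = begin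
  fromℕ (suc (m ℕ.+ n))        ≡⟨ fromℕ-suc (m ℕ.+ n) ⟩
  1ℚ + fromℕ (m ℕ.+ n)         ≡⟨ cong (λ q → 1ℚ + q) (fromℕ-+ m n) ⟩
  1ℚ + (fromℕ m + fromℕ n)     ≡⟨ +-assoc 1ℚ (fromℕ m) (fromℕ n) ⟨
  1ℚ + fromℕ m + fromℕ n       ≡⟨ cong (_+ fromℕ n) (fromℕ-suc m) ⟨
  fromℕ (suc m) + fromℕ n      ∎
  where open ≡-Reasoning

fromℕ-* : ∀ m n → fromℕ (m ℕ.* n) ≡ fromℕ m * fromℕ n
fromℕ-* zero    n = sym (*-zeroˡ (fromℕ n))
fromℕ-* (suc m) n = begin
  fromℕ (n ℕ.+ m ℕ.* n)               ≡⟨ fromℕ-+ n (m ℕ.* n) ⟩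
  fromℕ n + fromℕ (m ℕ.* n)           ≡⟨ cong (λ q → fromℕ n + q) (fromℕ-* m n) ⟩
  fromℕ n + fromℕ m * fromℕ n         ≡⟨ cong (_+ fromℕ m * fromℕ n) (*-identityˡ (fromℕ n)) ⟨
  1ℚ * fromℕ n + fromℕ m * fromℕ n    ≡⟨ *-distribʳ-+ (fromℕ n) 1ℚ (fromℕ m) ⟨
  (1ℚ + fromℕ m) * fromℕ n            ≡⟨ cong (_* fromℕ n) (fromℕ-suc m) ⟨
  fromℕ (suc m) * fromℕ n             ∎
  where open ≡-Reasoning

fromℕ-mono-≤ : ∀ {m n} → m ℕ.≤ n → fromℕ m ≤ fromℕ n
fromℕ-mono-≤ m≤n = *≤* (ℤ.*-monoʳ-≤-nonNeg (+ 1) (+≤+ m≤n))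

inv-nonNeg : ∀ m → NonNegative (inv m)
inv-nonNeg zero    = _
inv-nonNeg (suc m) = normalize-nonNeg 1 (suc m)

inv-suc : ∀ m → inv (suc m) ≡ 1/ fromℕ (suc m)
inv-suc m = ↥p/↧p≡p (mkℚ (+ 1) m (1-coprimeTo (suc m)))

fromℕ*inv≡1 : ∀ m .{{_ : NonZero m}} → fromℕ m * inv m ≡ 1ℚ
fromℕ*inv≡1 (suc m) = trans (cong (fromℕ (suc m) *_) (inv-suc m)) (*-inverseʳ (fromℕ (suc m)))

fromℕ*inv-cross : ∀ {P Q} x y z .{{_ : NonZero P}} .{{_ : NonZero Q}} →
  x ℕ.* Q ≡ y ℕ.* P ℕ.+ z ℕ.* Q →
  fromℕ x * inv P ≡ fromℕ y * inv Q + fromℕ z * inv P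
fromℕ*inv-cross {P} {Q} x y z xQ≡yP+zQ = begin
  X * p                                   ≡⟨ *-identityʳ (X * p) ⟨
  X * p * 1ℚ                              ≡⟨ cong (λ r → X * p * r) (fromℕ*inv≡1 Q) ⟨
  X * p * (Q' * q)                        ≡⟨ interchange X p Q' q ⟩
  X * Q' * (p * q)                        ≡⟨ cong (_* (p * q)) (fromℕ-* x Q) ⟨
  fromℕ (x ℕ.* Q) * (p * q)               ≡⟨ cong (λ r → fromℕ r * (p * q)) xQ≡yP+zQ ⟩
  fromℕ (y ℕ.* P ℕ.+ z ℕ.* Q) * (p * q)   ≡⟨ cong (_* (p * q)) (trans (fromℕ-+ (y ℕ.* P) (z ℕ.* Q))
                                                (cong₂ _+_ (fromℕ-* y P) (fromℕ-* z Q))) ⟩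
  (Y * P' + Z * Q') * (p * q)             ≡⟨ redistribute Y Z P' Q' p q ⟩
  Y * q * (P' * p) + Z * p * (Q' * q)     ≡⟨ cong₂ (λ r s → Y * q * r + Z * p * s) (fromℕ*inv≡1 P) (fromℕ*inv≡1 Q) ⟩
  Y * q * 1ℚ + Z * p * 1ℚ                 ≡⟨ cong₂ _+_ (*-identityʳ (Y * q)) (*-identityʳ (Z * p)) ⟩
  Y * q + Z * p                           ∎
  where
  open ≡-Reasoning
  X = fromℕ x
  Y = fromℕ y
  Z = fromℕ z
  P' = fromℕ P
  Q' = fromℕ Q
  p = inv P
  q = inv Q
  interchange : ∀ a b c d → a * b * (c * d) ≡ a * c * (b * d)
  interchange = solve-∀ ℚ-ring
  redistribute : ∀ a b c d e f → (a * c + b * d) * (e * f) ≡ a * f * (c * e) + b * e * (d * f)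
  redistribute = solve-∀ ℚ-ring

∃inv≤ : ∀ ε → 0ℚ < ε → ∃ λ d → inv (suc d) ≤ ε
∃inv≤ ε@(mkℚ +[1+ k ] d _) _ =
  d , subst (_≤ ε) (sym (inv-suc d))
            (*≤* {1/ fromℕ (suc d)} (ℤ.*-monoʳ-≤-nonNeg (+ suc d) {+ 1} {+ suc k} (+≤+ (s≤s z≤n))))
∃inv≤ (mkℚ (+ zero) _ _) 0<ε with () ← positive 0<ε
∃inv≤ (mkℚ -[1+ _ ] _ _) 0<ε with () ← positive 0<ε

fromℕ≤fromℕ*ε : ∀ {K n d ε} → inv (suc d) ≤ ε → K ℕ.* suc d ℕ.≤ n → fromℕ K ≤ fromℕ n * ε
fromℕ≤fromℕ*ε {K} {n} {d} {ε} 1/[d+1]≤ε K[d+1]≤n = begin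
  fromℕ K                                   ≡⟨ *-identityʳ (fromℕ K) ⟨
  fromℕ K * 1ℚ                              ≡⟨ cong (fromℕ K *_) (fromℕ*inv≡1 (suc d)) ⟨
  fromℕ K * (fromℕ (suc d) * inv (suc d))   ≡⟨ *-assoc (fromℕ K) (fromℕ (suc d)) (inv (suc d)) ⟨
  fromℕ K * fromℕ (suc d) * inv (suc d)     ≡⟨ cong (_* inv (suc d)) (fromℕ-* K (suc d)) ⟨
  fromℕ (K ℕ.* suc d) * inv (suc d)         ≤⟨ *-monoʳ-≤-nonNeg (inv (suc d)) {{inv-nonNeg (suc d)}}
                                                 (fromℕ-mono-≤ {K ℕ.* suc d} K[d+1]≤n) ⟩
  fromℕ n * inv (suc d)                     ≤⟨ *-monoˡ-≤-nonNeg (fromℕ n) 1/[d+1]≤ε ⟩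
  fromℕ n * ε                               ∎
  where open ≤-Reasoning

fromℕ*inv≤1 : ∀ {l c} → l ℕ.≤ c → fromℕ l * inv c ≤ 1ℚ
fromℕ*inv≤1 {l} {zero}  _   = ≤-trans (≤-reflexive (*-zeroʳ (fromℕ l))) (*≤* (+≤+ z≤n))
fromℕ*inv≤1 {l} {suc c} l≤c =
  ≤-trans (*-monoʳ-≤-nonNeg (inv (suc c)) {{inv-nonNeg (suc c)}} (fromℕ-mono-≤ l≤c))
          (≤-reflexive (fromℕ*inv≡1 (suc c)))

scaled-≤⇒≤+ε : ∀ {n K p q ε} → 0 ℕ.< n →
               fromℕ n * p ≤ fromℕ n * q + fromℕ K → fromℕ K ≤ fromℕ n * ε → p ≤ q + ε
scaled-≤⇒≤+ε {suc n} {K} {p} {q} {ε} _ np≤nq+K K≤nε = *-cancelˡ-≤-pos (fromℕ (suc n)) (begin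
  fromℕ (suc n) * p                       ≤⟨ np≤nq+K ⟩
  fromℕ (suc n) * q + fromℕ K             ≤⟨ +-monoʳ-≤ (fromℕ (suc n) * q) K≤nε ⟩
  fromℕ (suc n) * q + fromℕ (suc n) * ε   ≡⟨ *-distribˡ-+ (fromℕ (suc n)) q ε ⟨
  fromℕ (suc n) * (q + ε)                 ∎)
  where open ≤-Reasoning

-- Finite sums and the Lubell bound

-- h G is definitionally sumBy (λ F → inv (v G C ∣ F ∣)) (edges G).
sumBy : ∀ {A : Set} → (A → ℚ) → List A → ℚ
sumBy f = foldr (λ a s → f a + s) 0ℚ

module _ {A : Set} where

  sumBy-cong : ∀ {f g : A → ℚ} (L : List A) → (∀ a → f a ≡ g a) → sumBy f L ≡ sumBy g L
  sumBy-cong []      f≗g = refl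
  sumBy-cong (a ∷ L) f≗g = cong₂ _+_ (f≗g a) (sumBy-cong L f≗g)

  sumBy-mono-≤ : ∀ {f g : A → ℚ} (L : List A) → (∀ {a} → a List.∈ L → f a ≤ g a) → sumBy f L ≤ sumBy g L
  sumBy-mono-≤ []      f≤g = ≤-refl
  sumBy-mono-≤ (a ∷ L) f≤g = +-mono-≤ (f≤g (here refl)) (sumBy-mono-≤ L (f≤g ∘ there))

  sumBy-+ : ∀ (f g : A → ℚ) L → sumBy (λ a → f a + g a) L ≡ sumBy f L + sumBy g L
  sumBy-+ f g []      = refl
  sumBy-+ f g (a ∷ L) = trans (cong (λ s → f a + g a + s) (sumBy-+ f g L))
                              (interchange (f a) (g a) (sumBy f L) (sumBy g L))
    where
    interchange : ∀ a b c d → a + b + (c + d) ≡ a + c + (b + d)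
    interchange = solve-∀ ℚ-ring

  *-distribˡ-sumBy : ∀ c (f : A → ℚ) L → c * sumBy f L ≡ sumBy (λ a → c * f a) L
  *-distribˡ-sumBy c f []      = *-zeroʳ c
  *-distribˡ-sumBy c f (a ∷ L) = trans (*-distribˡ-+ c (f a) (sumBy f L))
                                       (cong (λ s → c * f a + s) (*-distribˡ-sumBy c f L))

  sumBy-const : ∀ {f : A → ℚ} {c} {L} → All (λ a → f a ≡ c) L → sumBy f L ≡ fromℕ (length L) * c
  sumBy-const {c = c} []                  = sym (*-zeroˡ c)
  sumBy-const {f} {c} {a ∷ L} (fa≡c ∷ fL≡c) =
    trans (cong₂ _+_ fa≡c (sumBy-const fL≡c)) (sym (fromℕ-suc-* (length L) c))

  sumBy-map : ∀ {B : Set} (f : B → ℚ) (g : A → B) L → sumBy f (map g L) ≡ sumBy (f ∘ g) L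
  sumBy-map f g []      = refl
  sumBy-map f g (a ∷ L) = cong (λ s → f (g a) + s) (sumBy-map f g L)

  sumBy-filter : ∀ {p} {P : Pred A p} (P? : Decidable P) (f : A → ℚ) L →
                 sumBy f (filter P? L) ≡ sumBy (λ a → if does (P? a) then f a else 0ℚ) L
  sumBy-filter P? f []      = refl
  sumBy-filter P? f (a ∷ L) with does (P? a)
  ... | true  = cong (λ s → f a + s) (sumBy-filter P? f L)
  ... | false = trans (sumBy-filter P? f L) (sym (+-identityˡ _))

  sumBy-partition : ∀ {p} {P : Pred A p} (P? : Decidable P) (f : A → ℚ) L →
                    sumBy f L ≡ sumBy f (filter P? L) + sumBy f (filter (∁? P?) L)
  sumBy-partition P? f L = begin
    sumBy f L                                     ≡⟨ sumBy-cong L (λ a → split (does (P? a)) (f a)) ⟩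
    sumBy (λ a → select a + reject a) L           ≡⟨ sumBy-+ select reject L ⟩
    sumBy select L + sumBy reject L               ≡⟨ cong₂ _+_ (sumBy-filter P? f L) (sumBy-filter (∁? P?) f L) ⟨
    sumBy f (filter P? L) + sumBy f (filter (∁? P?) L) ∎
    where
    open ≡-Reasoning
    select reject : A → ℚ
    select a = if does (P? a) then f a else 0ℚ
    reject a = if not (does (P? a)) then f a else 0ℚ
    split : ∀ b q → q ≡ (if b then q else 0ℚ) + (if not b then q else 0ℚ)
    split true  q = sym (+-identityʳ q)
    split false q = sym (+-identityˡ q)

∑-sumBy-comm : ∀ {A : Set} n (g : Fin n → A → ℚ) L →
               ∑[ x < n ] sumBy (g x) L ≡ sumBy (λ a → ∑[ x < n ] g x a) L
∑-sumBy-comm n g []      = sum-replicate-zero n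
∑-sumBy-comm n g (a ∷ L) = trans (∑-distrib-+ (λ x → g x a) (λ x → sumBy (g x) L))
                                 (cong (λ s → ∑[ x < n ] g x a + s) (∑-sumBy-comm n g L))

∑-indicator : ∀ {n} (F : Subset n) q → ∑[ x < n ] (if does (x ∈? F) then q else 0ℚ) ≡ fromℕ ∣ F ∣ * q
∑-indicator []            q = sym (*-zeroˡ q)
∑-indicator (inside ∷ F)  q = trans (cong (λ s → q + s) (∑-indicator F q)) (sym (fromℕ-suc-* ∣ F ∣ q))
∑-indicator (outside ∷ F) q = trans (+-identityˡ _) (∑-indicator F q)

∑≤fromℕ*bound : ∀ {n} {f : Fin n → ℚ} {q} → (∀ x → f x ≤ q) → ∑[ x < n ] f x ≤ fromℕ n * q
∑≤fromℕ*bound {zero}  {q = q} _   = ≤-reflexive (sym (*-zeroˡ q))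
∑≤fromℕ*bound {suc n} {q = q} f≤q = ≤-trans (+-mono-≤ (f≤q zero) (∑≤fromℕ*bound (f≤q ∘ suc)))
                                            (≤-reflexive (sym (fromℕ-suc-* n q)))

lubell : ∀ {n} K {L : List (Subset n)} → Unique L → All (λ F → ∣ F ∣ ℕ.< K) L →
         sumBy (λ F → inv (n C ∣ F ∣)) L ≤ fromℕ K
lubell zero    {[]}    _ _          = ≤-refl
lubell zero    {_ ∷ _} _ (() ∷ _)
lubell {n} (suc K) {L} unique sizes = begin
  sumBy w L                                       ≡⟨ sumBy-partition size≟K w L ⟩
  sumBy w (filter size≟K L) + sumBy w (filter (∁? size≟K) L)
    ≤⟨ +-mono-≤ layer≤1 (lubell K (Unique.filter⁺ (∁? size≟K) unique) smaller) ⟩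
  1ℚ + fromℕ K                                    ≡⟨ fromℕ-suc K ⟨
  fromℕ (suc K)                                   ∎
  where
  open ≤-Reasoning
  w = λ (F : Subset n) → inv (n C ∣ F ∣)
  size≟K = λ (F : Subset n) → ∣ F ∣ ℕ.≟ K
  layer = filter size≟K L
  layer-sizes : All (λ F → ∣ F ∣ ≡ K) layer
  layer-sizes = all-filter size≟K L
  layer≤1 : sumBy w layer ≤ 1ℚ
  layer≤1 = begin
    sumBy w layer                        ≡⟨ sumBy-const (All.map (cong (λ k → inv (n C k))) layer-sizes) ⟩
    fromℕ (length layer) * inv (n C K)   ≤⟨ fromℕ*inv≤1 (length≤nCk (Unique.filter⁺ size≟K unique) layer-sizes) ⟩
    1ℚ                                   ∎
  smaller : All (λ F → ∣ F ∣ ℕ.< K) (filter (∁? size≟K) L)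
  smaller = All.tabulate λ F∈ → let (F∈L , size≢K) = ∈-filter⁻ (∁? size≟K) F∈
                                 in ℕ.≤∧≢⇒< (ℕ.≤-pred (All.lookup sizes F∈L)) size≢K

-- Links and suspensions

x∉p-x : ∀ {n} {x : Fin n} (p : Subset n) → x ∉ p - x
x∉p-x {x = zero}  (_ ∷ p) ()
x∉p-x {x = suc x} (_ ∷ p) (there x∈p-x) = x∉p-x p x∈p-x

∣p-x∣+1≡∣p∣ : ∀ {n} {x : Fin n} {p : Subset n} → x ∈ p → suc ∣ p - x ∣ ≡ ∣ p ∣
∣p-x∣+1≡∣p∣ {p = inside  ∷ p} here        = cong (suc ∘ ∣_∣) (p─⊥≡p p)
∣p-x∣+1≡∣p∣ {p = inside  ∷ p} (there x∈p) = cong suc (∣p-x∣+1≡∣p∣ x∈p)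
∣p-x∣+1≡∣p∣ {p = outside ∷ p} (there x∈p) = ∣p-x∣+1≡∣p∣ x∈p

p-x≡q-x⇒p≡q : ∀ {n} {x : Fin n} {p q : Subset n} → x ∈ p → x ∈ q → p - x ≡ q - x → p ≡ q
p-x≡q-x⇒p≡q {x = x} {p} {q} x∈p x∈q p-x≡q-x = ⊆-antisym (⊆-restore p-x≡q-x x∈q) (⊆-restore (sym p-x≡q-x) x∈p)
  where
  ⊆-restore : ∀ {r s} → r - x ≡ s - x → x ∈ s → ∀ {y} → y ∈ r → y ∈ s
  ⊆-restore {r} {s} r-x≡s-x x∈s {y} y∈r with y ≟ x
  ... | yes refl = x∈s
  ... | no  y≢x  = p─q⊆p s ⁅ x ⁆ (subst (y ∈_) r-x≡s-x (x∈p∧x≢y⇒x∈p-y y∈r y≢x))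

Unique-map⁺ : ∀ {A B : Set} {p} {P : Pred A p} {f : A → B} {xs} →
              (∀ {a b} → P a → P b → f a ≡ f b → a ≡ b) → All P xs → Unique xs → Unique (map f xs)
Unique-map⁺ f-inj []         []           = []
Unique-map⁺ f-inj (Pa ∷ Pxs) (a∉xs ∷ uxs) =
  map⁺ (All.zipWith (λ (Pb , a≢b) fa≡fb → a≢b (f-inj Pa Pb fa≡fb)) (Pxs , a∉xs)) ∷ Unique-map⁺ f-inj Pxs uxs

link : (G : Hypergraph) → Fin (v G) → Hypergraph
link G x = record
  { v      = v G
  ; edges  = map (_- x) (filter (x ∈?_) (edges G))
  ; unique = Unique-map⁺ p-x≡q-x⇒p≡q (all-filter (x ∈?_) (edges G)) (Unique.filter⁺ (x ∈?_) (unique G))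
  }

∈-link⁻ : ∀ {G x F′} → F′ List.∈ edges (link G x) → ∃ λ F → F List.∈ edges G × x ∈ F × F′ ≡ F - x
∈-link⁻ {G} {x} F′∈ with ∈-map⁻ (_- x) F′∈
... | F , F∈ , refl with ∈-filter⁻ (x ∈?_) F∈
... | F∈G , x∈F = F , F∈G , x∈F , refl

∈-S⁻ : ∀ {H E′} → E′ List.∈ edges (S H) → ∃ λ E → E List.∈ edges H × E′ ≡ inside ∷ E
∈-S⁻ = ∈-map⁻ (inside ∷_)

link-sizesIn : ∀ {H G} x → SizesIn G (S H) → SizesIn (link G x) H
link-sizesIn {H} {G} x sizes F′ F′∈ with ∈-link⁻ {G} F′∈
... | F , F∈ , x∈F , refl with sizes F F∈
... | E′ , E′∈ , ∣F∣≡∣E′∣ with ∈-S⁻ {H} E′∈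
... | E , E∈ , refl = E , E∈ , ℕ.suc-injective (trans (∣p-x∣+1≡∣p∣ x∈F) ∣F∣≡∣E′∣)

-- ImageIsEdge H G f E unfolds to Σ F ∈ edges G, Image f E F.
Image : ∀ {m n} → (Fin m → Fin n) → Subset m → Subset n → Set
Image {m} f E F = ∀ j → (j ∈ F) ⇔ (Σ (Fin m) λ i → (i ∈ E) × (f i ≡ j))

Image-cong : ∀ {m n} {f g : Fin m → Fin n} {E F} → (∀ {i} → i ∈ E → f i ≡ g i) → Image f E F → Image g E F
Image-cong f≗g f[E]≡F j = mk⇔
  (λ j∈F → let (i , i∈E , fi≡j) = Equivalence.to (f[E]≡F j) j∈F in i , i∈E , trans (sym (f≗g i∈E)) fi≡j)
  (λ { (i , i∈E , refl) → Equivalence.from (f[E]≡F j) (i , i∈E , f≗g i∈E) })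

Image-suspend : ∀ {m n} {f : Fin m → Fin n} {E F x} → x ∈ F → Image f E (F - x) →
                Image (x Vector.∷ f) (inside ∷ E) F
Image-suspend {f = f} {E} {F} {x} x∈F f[E]≡F-x j = mk⇔ to from
  where
  to : j ∈ F → Σ (Fin _) λ i → (i ∈ inside ∷ E) × ((x Vector.∷ f) i ≡ j)
  to j∈F with j ≟ x
  ... | yes refl = zero , here , refl
  ... | no  j≢x  = let (i , i∈E , fi≡j) = Equivalence.to (f[E]≡F-x j) (x∈p∧x≢y⇒x∈p-y j∈F j≢x)
                   in suc i , there i∈E , fi≡j
  from : (Σ (Fin _) λ i → (i ∈ inside ∷ E) × ((x Vector.∷ f) i ≡ j)) → j ∈ F
  from (zero  , _         , refl) = x∈F
  from (suc i , there i∈E , refl) = p─q⊆p F ⁅ x ⁆ (Equivalence.from (f[E]≡F-x (f i)) (i , i∈E , refl))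

Image-avoids : ∀ {m n} {f : Fin m → Fin n} {E F x} → Image f E (F - x) → ∀ {i} → i ∈ E → f i ≢ x
Image-avoids {f = f} {F = F} f[E]≡F-x {i} i∈E fi≡x =
  x∉p-x F (subst (_∈ F - _) fi≡x (Equivalence.from (f[E]≡F-x (f i)) (i , i∈E , refl)))

∃∉image : ∀ {m n} → m ℕ.< n → (f : Fin m → Fin n) → ∃ λ y → ∀ i → f i ≢ y
∃∉image {m} {n} m<n f with any? (λ y → all? (λ i → ¬? (f i ≟ y)))
... | yes missed  = missed
... | no  ¬missed = contradiction (injective⇒≤ preimage-injective) (ℕ.<⇒≱ m<n)
  where
  preimage : ∀ y → ∃ λ i → f i ≡ y
  preimage y = map₂ (decidable-stable (f _ ≟ y))
                    (¬∀⟶∃¬ m (λ i → f i ≢ y) (λ i → ¬? (f i ≟ y)) (¬missed ∘ (y ,_)))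
  preimage-injective : Injective _≡_ _≡_ (proj₁ ∘ preimage)
  preimage-injective {y} {z} eq =
    trans (sym (proj₂ (preimage y))) (trans (cong f eq) (proj₂ (preimage z)))

avoid-vertex : ∀ {m n} {f : Fin m → Fin n} → Injective _≡_ _≡_ f → m ℕ.< n → (x : Fin n) →
               Σ (Fin m → Fin n) λ g →
                 Injective _≡_ _≡_ g × (∀ i → g i ≢ x) × (∀ i → f i ≢ x → g i ≡ f i)
avoid-vertex {m} {n} {f} f-inj m<n x with ∃∉image m<n f
... | y , y∉f = g , g-injective , g≢x , g≗f
  where
  g : Fin m → Fin n
  g i with f i ≟ x
  ... | yes _ = y
  ... | no  _ = f i
  g≢x : ∀ i → g i ≢ x
  g≢x i with f i ≟ x
  ... | yes fi≡x = λ y≡x → y∉f i (trans fi≡x (sym y≡x))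
  ... | no  fi≢x = fi≢x
  g≗f : ∀ i → f i ≢ x → g i ≡ f i
  g≗f i fi≢x with f i ≟ x
  ... | yes fi≡x = contradiction fi≡x fi≢x
  ... | no  _    = refl
  g-injective : Injective _≡_ _≡_ g
  g-injective {i} {j} gi≡gj with f i ≟ x | f j ≟ x
  ... | yes fi≡x | yes fj≡x = f-inj (trans fi≡x (sym fj≡x))
  ... | yes _    | no  _    = contradiction (sym gi≡gj) (y∉f j)
  ... | no  _    | yes _    = contradiction gi≡gj (y∉f i)
  ... | no  _    | no  _    = f-inj gi≡gj

-- x is isolated in the link, but an embedding of H may still use it; since v H < v G it can be
-- moved off x, which then becomes the image of the suspension vertex.
⊆ᴴ-link⇒S⊆ᴴ : ∀ {H G} {x : Fin (v G)} → v H ℕ.< v G → H ⊆ᴴ link G x → S H ⊆ᴴ G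
⊆ᴴ-link⇒S⊆ᴴ {H} {G} {x} vH<vG (f , f-inj , f-image) with avoid-vertex f-inj vH<vG x
... | g , g-inj , g≢x , g≗f = (x Vector.∷ g) , x∷g-injective , x∷g-image
  where
  x∷g-injective : Injective _≡_ _≡_ (x Vector.∷ g)
  x∷g-injective {zero}  {zero}  _  = refl
  x∷g-injective {zero}  {suc j} eq = contradiction (sym eq) (g≢x j)
  x∷g-injective {suc i} {zero}  eq = contradiction eq (g≢x i)
  x∷g-injective {suc i} {suc j} eq = cong suc (g-inj eq)
  x∷g-image : ∀ E′ → E′ List.∈ edges (S H) → ImageIsEdge (S H) G (x Vector.∷ g) E′
  x∷g-image E′ E′∈ with ∈-S⁻ {H} E′∈
  ... | E , E∈ , refl with f-image E E∈
  ... | F′ , F′∈ , f[E]≡F′ with ∈-link⁻ {G} F′∈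
  ... | F , F∈ , x∈F , refl =
    F , F∈ , Image-suspend x∈F (Image-cong (λ i∈E → sym (g≗f _ (Image-avoids f[E]≡F′ i∈E))) f[E]≡F′)

-- The averaging estimate

edge-size : ∀ {H G} → SizesIn G (S H) → ∀ {F} → F List.∈ edges G → ∃ λ j → ∣ F ∣ ≡ suc j × j ℕ.≤ v H
edge-size {H} sizes {F} F∈ with sizes F F∈
... | E′ , E′∈ , ∣F∣≡∣E′∣ with ∈-S⁻ {H} E′∈
... | E , _ , refl = ∣ E ∣ , ∣F∣≡∣E′∣ , ∣p∣≤n E

inv-C-split : ∀ {n j} → suc j ℕ.≤ n →
              fromℕ n * inv (n C suc j) ≡ fromℕ (suc j) * inv (n C j) + fromℕ j * inv (n C suc j)
inv-C-split {n} {j} j<n = fromℕ*inv-cross n (suc j) j {{C[j+1]≢0}} {{C[j]≢0}} (n*nCk≡[k+1]*nC[k+1]+k*nCk n j)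
  where
  C[j+1]≢0 = >-nonZero (k≤n⇒nCk>0 j<n)
  C[j]≢0   = >-nonZero (k≤n⇒nCk>0 (ℕ.<⇒≤ j<n))

∑-h-link : ∀ G →
  ∑[ x < v G ] h (link G x) ≡ sumBy (λ F → fromℕ ∣ F ∣ * inv (v G C ℕ.pred ∣ F ∣)) (edges G)
∑-h-link G = begin
  ∑[ x < n ] h (link G x)
    ≡⟨ sum-cong-≗ (λ x → trans (sumBy-map w (_- x) (filter (x ∈?_) E))
                                (sumBy-filter (x ∈?_) (w ∘ (_- x)) E)) ⟩
  ∑[ x < n ] sumBy (λ F → if does (x ∈? F) then w (F - x) else 0ℚ) E
    ≡⟨ sum-cong-≗ (λ x → sumBy-cong E (∣F-x∣≡pred∣F∣ x)) ⟩
  ∑[ x < n ] sumBy (λ F → if does (x ∈? F) then inv (n C ℕ.pred ∣ F ∣) else 0ℚ) E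
    ≡⟨ ∑-sumBy-comm n _ E ⟩
  sumBy (λ F → ∑[ x < n ] (if does (x ∈? F) then inv (n C ℕ.pred ∣ F ∣) else 0ℚ)) E
    ≡⟨ sumBy-cong E (λ F → ∑-indicator F _) ⟩
  sumBy (λ F → fromℕ ∣ F ∣ * inv (n C ℕ.pred ∣ F ∣)) E ∎
  where
  open ≡-Reasoning
  n = v G
  E = edges G
  w = λ (F : Subset n) → inv (n C ∣ F ∣)
  ∣F-x∣≡pred∣F∣ : ∀ x F → (if does (x ∈? F) then w (F - x) else 0ℚ)
                        ≡ (if does (x ∈? F) then inv (n C ℕ.pred ∣ F ∣) else 0ℚ)
  ∣F-x∣≡pred∣F∣ x F with x ∈? F
  ... | yes x∈F = cong (λ k → inv (n C ℕ.pred k)) (∣p-x∣+1≡∣p∣ x∈F)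
  ... | no  _   = refl

edge-weight-bound : ∀ {n m j} → suc j ℕ.≤ n → j ℕ.≤ m →
  fromℕ n * inv (n C suc j) ≤ fromℕ (suc j) * inv (n C j) + fromℕ m * inv (n C suc j)
edge-weight-bound {n} {m} {j} j<n j≤m = begin
  fromℕ n * inv (n C suc j)                                  ≡⟨ inv-C-split j<n ⟩
  fromℕ (suc j) * inv (n C j) + fromℕ j * inv (n C suc j)    ≤⟨ +-monoʳ-≤ (fromℕ (suc j) * inv (n C j)) j/C≤m/C ⟩
  fromℕ (suc j) * inv (n C j) + fromℕ m * inv (n C suc j)    ∎
  where
  open ≤-Reasoning
  j/C≤m/C : fromℕ j * inv (n C suc j) ≤ fromℕ m * inv (n C suc j)
  j/C≤m/C = *-monoʳ-≤-nonNeg (inv (n C suc j)) {{inv-nonNeg (n C suc j)}} (fromℕ-mono-≤ j≤m)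

n*h≤∑h-link+m*h : ∀ {H G} → SizesIn G (S H) →
                  fromℕ (v G) * h G ≤ ∑[ x < v G ] h (link G x) + fromℕ (v H) * h G
n*h≤∑h-link+m*h {H} {G} sizes = begin
  fromℕ n * h G                                   ≡⟨ *-distribˡ-sumBy (fromℕ n) w E ⟩
  sumBy (λ F → fromℕ n * w F) E                   ≤⟨ sumBy-mono-≤ E bound ⟩
  sumBy (λ F → linkPart F + fromℕ m * w F) E      ≡⟨ sumBy-+ linkPart (λ F → fromℕ m * w F) E ⟩
  sumBy linkPart E + sumBy (λ F → fromℕ m * w F) E
    ≡⟨ cong₂ _+_ (∑-h-link G) (*-distribˡ-sumBy (fromℕ m) w E) ⟨
  ∑[ x < n ] h (link G x) + fromℕ m * h G         ∎
  where
  open ≤-Reasoning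
  n = v G
  m = v H
  E = edges G
  w = λ (F : Subset n) → inv (n C ∣ F ∣)
  linkPart = λ (F : Subset n) → fromℕ ∣ F ∣ * inv (n C ℕ.pred ∣ F ∣)
  bound : ∀ {F} → F List.∈ E → fromℕ n * w F ≤ linkPart F + fromℕ m * w F
  bound {F} F∈ with edge-size {H} {G} sizes F∈
  ... | j , ∣F∣≡1+j , j≤m =
    subst (λ k → fromℕ n * inv (n C k) ≤ fromℕ k * inv (n C ℕ.pred k) + fromℕ m * inv (n C k))
          (sym ∣F∣≡1+j) (edge-weight-bound {m = m} (subst (ℕ._≤ n) ∣F∣≡1+j (∣p∣≤n F)) j≤m)

∃link-estimate : ∀ {H G} → SizesIn G (S H) → Fin (v G) →
                 ∃ λ x → fromℕ (v G) * h G ≤ fromℕ (v G) * h (link G x) + fromℕ (v H ℕ.* suc (suc (v H)))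
∃link-estimate {H} {G} sizes x₁ = x₀ , (begin
  fromℕ n * h G                                         ≤⟨ n*h≤∑h-link+m*h {H} {G} sizes ⟩
  ∑[ x < n ] h (link G x) + fromℕ m * h G               ≤⟨ +-mono-≤ (∑≤fromℕ*bound maximal) m*h≤m*[m+2] ⟩
  fromℕ n * h (link G x₀) + fromℕ m * fromℕ (suc (suc m)) ≡⟨ cong (λ q → fromℕ n * h (link G x₀) + q)
                                                                (fromℕ-* m (suc (suc m))) ⟨
  fromℕ n * h (link G x₀) + fromℕ (m ℕ.* suc (suc m))   ∎)
  where
  open ≤-Reasoning
  n = v G
  m = v H
  x₀ = argmax (h ∘ link G) x₁ (allFin n)
  maximal : ∀ x → h (link G x) ≤ h (link G x₀)
  maximal x = All.lookup (f[xs]≤f[argmax] x₁ (allFin n)) (∈-allFin x)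
  small : All (λ F → ∣ F ∣ ℕ.< suc (suc m)) (edges G)
  small = All.tabulate λ F∈ → let (j , ∣F∣≡1+j , j≤m) = edge-size {H} {G} sizes F∈
                              in subst (ℕ._< suc (suc m)) (sym ∣F∣≡1+j) (ℕ.s≤s (ℕ.s≤s j≤m))
  m*h≤m*[m+2] : fromℕ m * h G ≤ fromℕ m * fromℕ (suc (suc m))
  m*h≤m*[m+2] = *-monoˡ-≤-nonNeg (fromℕ m) (lubell (suc (suc m)) (unique G) small)

mainTheorem17 : (H : Hypergraph) → (ε : ℚ) → 0ℚ < ε →
    Σ ℕ λ N → (n : ℕ) → n ≥ N →
      (G : Hypergraph) → Admissible (S H) n G →
        Σ Hypergraph λ G' → Admissible H n G' × (h G ≤ h G' + ε)
mainTheorem17 H ε 0<ε with ∃inv≤ ε 0<ε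
... | d , 1/[d+1]≤ε = K ℕ.* suc d ℕ.+ suc m , λ { n N≤n G (refl , sizes , S⊈G) →
  let m<n = ℕ.<-≤-trans (ℕ.m≤n+m (suc m) (K ℕ.* suc d)) N≤n
      x , estimate = ∃link-estimate {H} {G} sizes (fromℕ< m<n)
  in link G x , (refl , link-sizesIn {H} {G} x sizes , S⊈G ∘ ⊆ᴴ-link⇒S⊆ᴴ {H} {G} m<n)
              , scaled-≤⇒≤+ε {K = K} {q = h (link G x)} {ε} (ℕ.<-≤-trans (ℕ.s≤s ℕ.z≤n) m<n) estimate
                  (fromℕ≤fromℕ*ε 1/[d+1]≤ε (ℕ.≤-trans (ℕ.m≤m+n (K ℕ.* suc d) (suc m)) N≤n)) }
  where
  m = v H
  K = m ℕ.* suc (suc m)
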